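{- Let $\Sigma$ be an implicational base over a finite set $U$ with closure system $\mathcal{C}$, and let $(U_1,U_2)$ be an acyclic split of $\Sigma$. Let $\mathcal{C}_1$, $\mathcal{C}_2$ be the closure systems of $\Sigma[U_1]$ and $\Sigma[U_2]$, and $\phi_1$ the closure operator of $\mathcal{C}_1$. Let $C_2\in\mathcal{C}_2$ and let $\mathcal{B}^-=\min(\mathcal{C}_1\setminus(\mathrm{Ext}(C_2):U_1))$ be the family of inclusion-minimal sets of $\mathcal{C}_1$ not belonging to $\mathrm{Ext}(C_2):U_1$. Then for every $C_1\in\mathcal{C}_1$: $C_1\in\mathcal{B}^-$ if and only if $C_1\in\min\{\phi_1(A) : A\to b\in\Sigma[U_1,U_2],\ b\notin C_2\}$.
   Context: An implication over $U$ is written $A \to b$ with $A \subseteq U$ nonempty and $b \in U$; an implicational base is a finite set of implications. $C\subseteq U$ satisfies $\Sigma$ if for all $A\to b\in\Sigma$, $A\subseteq C$ implies $b\in C$; the closure system of $\Sigma$ is the family of subsets satisfying $\Sigma$, and its closure operator maps $X$ to the smallest closed superset of $X$. For $X\subseteq U$, $\Sigma[X]=\{A\to b\in\Sigma: A\cup\{b\}\subseteq X\}$ (a base over $X$). A split of $\Sigma$ is a bipartition $(U_1,U_2)$ of $U$ into nonempty disjoint sets such that every premise is contained in $U_1$ or in $U_2$; $\Sigma[U_1,U_2]:=\Sigma\setminus(\Sigma[U_1]\cup\Sigma[U_2])$; the split is acyclic if $A\subseteq U_1$ for every $A\to b\in\Sigma[U_1,U_2]$. For $C_2\in\mathcal{C}_2$,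 $\mathrm{Ext}(C_2)=\{C\in\mathcal{C}: C\cap U_2=C_2\}$ and $\mathrm{Ext}(C_2):U_1=\{C\cap U_1: C\in\mathrm{Ext}(C_2)\}$. $\min$ of a family denotes its inclusion-minimal members. -}

module Defs where

open import Data.Nat using (ℕ)
open import Data.Fin using (Fin)
open import Data.Fin.Subset using (Subset; _∈_; _∉_; _⊆_; _∩_; _∪_; ⁅_⁆; ⊤; ⊥; Nonempty)
open import Data.List using (List)
open import Data.List.Membership.Propositional renaming (_∈_ to _∈ₗ_)
open import Data.Product using (Σ; ∃; _×_)
open import Data.Sum using (_⊎_)
open import Relation.Binary.PropositionalEquality using (_≡_)
open import Relation.Nullary using (¬_)

record Imp (n : ℕ) : Set where
  constructor _⇒_∣_
  field
    prem : Subset n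
    concl : Fin n
    prem-nonempty : Nonempty prem
open Imp public

Base : ℕ → Set
Base n = List (Imp n)

ImpFamily : ℕ → Set₁
ImpFamily n = Imp n → Set

⟦_⟧ : ∀ {n} → Base n → ImpFamily n
⟦ Σ' ⟧ i = i ∈ₗ Σ'

_[_] : ∀ {n} → Base n → Subset n → ImpFamily n
(Σ' [ X ]) i = i ∈ₗ Σ' × (prem i ∪ ⁅ concl i ⁆) ⊆ X

_[_,_] : ∀ {n} → Base n → Subset n → Subset n → ImpFamily n
(Σ' [ U₁ , U₂ ]) i = i ∈ₗ Σ' × ¬ (Σ' [ U₁ ]) i × ¬ (Σ' [ U₂ ]) i

Satisfies : ∀ {n} → ImpFamily n → Subset n → Set
Satisfies F C = ∀ i → F i → prem i ⊆ C → concl i ∈ C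

Closed : ∀ {n} → Subset n → ImpFamily n → Subset n → Set
Closed X F C = C ⊆ X × Satisfies F C

IsClosureOf : ∀ {n} → Subset n → ImpFamily n → Subset n → Subset n → Set
IsClosureOf X F A Y = Closed X F Y × A ⊆ Y × (∀ Z → Closed X F Z → A ⊆ Z → Y ⊆ Z)

IsSplit : ∀ {n} → Base n → Subset n → Subset n → Set
IsSplit Σ' U₁ U₂ =
  Nonempty U₁ × Nonempty U₂ × (U₁ ∩ U₂ ≡ ⊥) × (U₁ ∪ U₂ ≡ ⊤) ×
  (∀ i → i ∈ₗ Σ' → prem i ⊆ U₁ ⊎ prem i ⊆ U₂)

IsAcyclicSplit : ∀ {n} → Base n → Subset n → Subset n → Set
IsAcyclicSplit Σ' U₁ U₂ =
  IsSplit Σ' U₁ U₂ × (∀ i → (Σ' [ U₁ , U₂ ]) i → prem i ⊆ U₁)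

ExtRestr : ∀ {n} → Base n → Subset n → Subset n → Subset n → Subset n → Set
ExtRestr Σ' U₁ U₂ C₂ X =
  ∃ λ C → Closed ⊤ ⟦ Σ' ⟧ C × C ∩ U₂ ≡ C₂ × C ∩ U₁ ≡ X

Min : ∀ {n} → (Subset n → Set) → Subset n → Set
Min 𝓕 C = 𝓕 C × (∀ D → 𝓕 D → D ⊆ C → D ≡ C)

-- A closed set X of Σ[U₁] fails to extend by C₂ exactly when it contains the
-- premise of a cross implication A → b with b ∉ C₂: such an implication forces b into any
-- extension, while otherwise X ∪ C₂ is itself closed for Σ (acyclicity rules out cross
-- implications with premise in U₂). The sets of 𝒞₁ containing one of these premises A have
-- the same minimal members as the family of their closures φ₁(A).
module Submission where

open import Defs
open import Data.Nat using (ℕ; _<_)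
open import Data.Nat.Induction using (<-wellFounded)
open import Induction.WellFounded using (Acc; acc)
open import Data.Fin using (Fin)
open import Data.Fin.Subset using (Subset; _∈_; _∉_; _⊆_; _∩_; _∪_; ⁅_⁆; ⊤; ⊥; ∣_∣)
open import Data.Fin.Subset.Properties
open import Data.List.Relation.Unary.Any using (any?)
open import Data.List.Relation.Unary.All using (all?; lookup; tabulate)
open import Data.List.Membership.Propositional using (find; lose) renaming (_∈_ to _∈ₗ_)
open import Data.Product using (∃; _×_; proj₁; proj₂)
open import Data.Sum using (_⊎_; inj₁; inj₂)
open import Data.Empty using (⊥-elim)
open import Function.Bundles using (_⇔_; mk⇔; Equivalence)
open import Function.Properties.Equivalence using () renaming (trans to ⇔-trans)
open import Relation.Nullary using (¬_; Dec; yes; no)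
open import Relation.Nullary.Decidable using (_×-dec_; ¬?; _→-dec_; decidable-stable)
open import Relation.Binary.PropositionalEquality using (_≡_; sym; cong; subst; module ≡-Reasoning)

-- _,_ stays out of scope of the final statement, where it would make Σ' [ U₁ , U₂ ] ambiguous.
module _ where
  open import Data.Product using (_,_)

  module _ {n : ℕ} where

    p⊆q⇒p∩q≡p : ∀ {p q : Subset n} → p ⊆ q → p ∩ q ≡ p
    p⊆q⇒p∩q≡p {p} {q} p⊆q = ⊆-antisym (p∩q⊆p p q) (λ x∈p → x∈p∩q⁺ (x∈p , p⊆q x∈p))

    p⊆q∧q∩r≡⊥⇒p∩r≡⊥ : ∀ {p q r : Subset n} → p ⊆ q → q ∩ r ≡ ⊥ → p ∩ r ≡ ⊥
    p⊆q∧q∩r≡⊥⇒p∩r≡⊥ {p} {q} {r} p⊆q q∩r≡⊥ = ⊆-antisym p∩r⊆⊥ (⊆-min (p ∩ r))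
      where
      p∩r⊆⊥ : p ∩ r ⊆ ⊥
      p∩r⊆⊥ x∈p∩r with x∈p∩q⁻ p r x∈p∩r
      ... | x∈p , x∈r = subst (_ ∈_) q∩r≡⊥ (x∈p∩q⁺ (p⊆q x∈p , x∈r))

    p⊆r∧q∩r≡⊥⇒[p∪q]∩r≡p : ∀ {p q r : Subset n} → p ⊆ r → q ∩ r ≡ ⊥ → (p ∪ q) ∩ r ≡ p
    p⊆r∧q∩r≡⊥⇒[p∪q]∩r≡p {p} {q} {r} p⊆r q∩r≡⊥ = begin
      (p ∪ q) ∩ r        ≡⟨ ∩-distribʳ-∪ r p q ⟩
      (p ∩ r) ∪ (q ∩ r)  ≡⟨ cong (_∪ (q ∩ r)) (p⊆q⇒p∩q≡p p⊆r) ⟩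
      p ∪ (q ∩ r)        ≡⟨ cong (p ∪_) q∩r≡⊥ ⟩
      p ∪ ⊥              ≡⟨ ∪-identityʳ p ⟩
      p                  ∎
      where open ≡-Reasoning

    p∩q≡⊥⇒x∈p⇒x∉q : ∀ {p q : Subset n} {x} → p ∩ q ≡ ⊥ → x ∈ p → x ∉ q
    p∩q≡⊥⇒x∈p⇒x∉q p∩q≡⊥ x∈p x∈q = ∉⊥ (subst (_ ∈_) p∩q≡⊥ (x∈p∩q⁺ (x∈p , x∈q)))

  module _ {n : ℕ} {x : Fin n} where

    p∪⁅x⁆⊆⁺ : ∀ {p r : Subset n} → p ⊆ r → x ∈ r → p ∪ ⁅ x ⁆ ⊆ r
    p∪⁅x⁆⊆⁺ {p} {r} p⊆r x∈r y∈p∪⁅x⁆ with x∈p∪q⁻ p ⁅ x ⁆ y∈p∪⁅x⁆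
    ... | inj₁ y∈p = p⊆r y∈p
    ... | inj₂ y∈⁅x⁆ = subst (_∈ r) (sym (x∈⁅y⁆⇒x≡y x y∈⁅x⁆)) x∈r

    p∪⁅x⁆⊆⁻ : ∀ {p r : Subset n} → p ∪ ⁅ x ⁆ ⊆ r → p ⊆ r × x ∈ r
    p∪⁅x⁆⊆⁻ p∪⁅x⁆⊆r = (λ y∈p → p∪⁅x⁆⊆r (x∈p∪q⁺ (inj₁ y∈p))) , p∪⁅x⁆⊆r (x∈p∪q⁺ (inj₂ (x∈⁅x⁆ x)))

  Min-cong : ∀ {n} {P Q : Subset n → Set} → (∀ {C} → P C ⇔ Q C) → ∀ {C} → Min P C ⇔ Min Q C
  Min-cong P⇔Q = mk⇔ (λ (pC , minC) → to P⇔Q pC , λ D qD → minC D (from P⇔Q qD))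
                     (λ (qC , minC) → from P⇔Q qC , λ D pD → minC D (to P⇔Q pD))
    where open Equivalence

  module _ {n : ℕ} {P : Subset n → Set} (P? : ∀ Z → Dec (P Z)) where

    Min-below : ∀ D → P D → ∃ λ M → Min P M × M ⊆ D
    Min-below D = go D (<-wellFounded ∣ D ∣)
      where
      go : ∀ D → Acc _<_ ∣ D ∣ → P D → ∃ λ M → Min P M × M ⊆ D
      go D (acc rec) pD with anySubset? (λ Z → P? Z ×-dec Z ⊂? D)
      ... | yes (Z , pZ , Z⊂D) with go Z (rec (p⊂q⇒∣p∣<∣q∣ Z⊂D)) pZ
      ...   | M , minM , M⊆Z = M , minM , ⊆-trans M⊆Z (p⊂q⇒p⊆q Z⊂D)
      go D (acc rec) pD | no ∄smaller = D , (pD , minimal) , ⊆-refl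
        where
        minimal : ∀ Z → P Z → Z ⊆ D → Z ≡ D
        minimal Z pZ Z⊆D = ⊆-antisym Z⊆D D⊆Z
          where
          D⊆Z : D ⊆ Z
          D⊆Z {x} x∈D with x ∈? Z
          ... | yes x∈Z = x∈Z
          ... | no x∉Z = ⊥-elim (∄smaller (Z , pZ , Z⊆D , x , x∈D , x∉Z))

  module _ {n : ℕ} {X : Subset n} {F : ImpFamily n} where

    ∩-closed : ∀ {A B} → Closed X F A → Closed X F B → Closed X F (A ∩ B)
    ∩-closed {A} {B} (A⊆X , A-sat) (_ , B-sat) =
      (λ x∈A∩B → A⊆X (p∩q⊆p A B x∈A∩B)) ,
      λ i Fi prem⊆A∩B → x∈p∩q⁺ ( A-sat i Fi (λ a → p∩q⊆p A B (prem⊆A∩B a))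
                               , B-sat i Fi (λ a → p∩q⊆q A B (prem⊆A∩B a)))

    -- Meeting a closed superset Z of A with M gives a closed superset of A below M.
    Min⇒IsClosureOf : ∀ {A M} → Min (λ Z → Closed X F Z × A ⊆ Z) M → IsClosureOf X F A M
    Min⇒IsClosureOf {A} {M} ((M-closed , A⊆M) , minM) = M-closed , A⊆M , least
      where
      least : ∀ Z → Closed X F Z → A ⊆ Z → M ⊆ Z
      least Z Z-closed A⊆Z {x} x∈M = p∩q⊆p Z M (subst (x ∈_) (sym Z∩M≡M) x∈M)
        where
        Z∩M≡M : Z ∩ M ≡ M
        Z∩M≡M = minM (Z ∩ M) (∩-closed Z-closed M-closed , λ a → x∈p∩q⁺ (A⊆Z a , A⊆M a))
                             (p∩q⊆q Z M)

    module _ (closed? : ∀ Z → Dec (Closed X F Z)) {I : Set} (G : I → Set) (gen : I → Subset n) where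

      Min-generated⇔Min-closure :
        ∀ {C} → Min (λ C → Closed X F C × ∃ λ i → G i × gen i ⊆ C) C
              ⇔ Min (λ Y → ∃ λ i → G i × IsClosureOf X F (gen i) Y) C
      Min-generated⇔Min-closure = mk⇔ to from
        where
        to : ∀ {C} → Min (λ C → Closed X F C × ∃ λ i → G i × gen i ⊆ C) C
                   → Min (λ Y → ∃ λ i → G i × IsClosureOf X F (gen i) Y) C
        to ((C-closed , i , Gi , gen⊆C) , minC) =
          (i , Gi , Min⇒IsClosureOf ((C-closed , gen⊆C) ,
                      λ Z (Z-closed , gen⊆Z) → minC Z (Z-closed , i , Gi , gen⊆Z))) ,
          λ Y (j , Gj , Y-closed , gen⊆Y , _) → minC Y (Y-closed , j , Gj , gen⊆Y)

        from : ∀ {C} → Min (λ Y → ∃ λ i → G i × IsClosureOf X F (gen i) Y) C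
                     → Min (λ C → Closed X F C × ∃ λ i → G i × gen i ⊆ C) C
        from {C} ((i , Gi , C-closed , gen⊆C , _) , minC) = (C-closed , i , Gi , gen⊆C) , minimal
          where
          minimal : ∀ D → Closed X F D × (∃ λ i → G i × gen i ⊆ D) → D ⊆ C → D ≡ C
          minimal D (D-closed , j , Gj , gen⊆D) D⊆C with
            Min-below (λ Z → closed? Z ×-dec gen j ⊆? Z) D (D-closed , gen⊆D)
          ... | M , minM , M⊆D = ⊆-antisym D⊆C (subst (_⊆ D) M≡C M⊆D)
            where
            M≡C : M ≡ C
            M≡C = minC M (j , Gj , Min⇒IsClosureOf minM) (⊆-trans M⊆D D⊆C)

  closed? : ∀ {n} (Σ' : Base n) (Y Z : Subset n) → Dec (Closed Y (Σ' [ Y ]) Z)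
  closed? Σ' Y Z = Z ⊆? Y ×-dec satisfies?
    where
    satisfies? : Dec (Satisfies (Σ' [ Y ]) Z)
    satisfies? with all? (λ i → (prem i ∪ ⁅ concl i ⁆ ⊆? Y) →-dec (prem i ⊆? Z) →-dec (concl i ∈? Z)) Σ'
    ... | yes all = yes λ i (i∈Σ , i⊆Y) → lookup all i∈Σ i⊆Y
    ... | no ¬all = no λ sat → ¬all (tabulate λ i∈Σ i⊆Y → sat _ (i∈Σ , i⊆Y))

  module AcyclicSplit
    {n : ℕ} (Σ' : Base n) {U₁ U₂ : Subset n}
    (acyclicSplit : IsAcyclicSplit Σ' U₁ U₂)
    {C₂ : Subset n} (C₂-closed : Closed U₂ (Σ' [ U₂ ]) C₂)
    where

    private
      U₁∩U₂≡⊥ : U₁ ∩ U₂ ≡ ⊥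
      U₁∩U₂≡⊥ = let ((_ , _ , U₁∩U₂≡⊥ , _) , _) = acyclicSplit in U₁∩U₂≡⊥

      U₂∩U₁≡⊥ : U₂ ∩ U₁ ≡ ⊥
      U₂∩U₁≡⊥ = subst (_≡ ⊥) (∩-comm U₁ U₂) U₁∩U₂≡⊥

      U₁∪U₂≡⊤ : U₁ ∪ U₂ ≡ ⊤
      U₁∪U₂≡⊤ = let ((_ , _ , _ , U₁∪U₂≡⊤ , _) , _) = acyclicSplit in U₁∪U₂≡⊤

      split : ∀ i → i ∈ₗ Σ' → prem i ⊆ U₁ ⊎ prem i ⊆ U₂
      split = let ((_ , _ , _ , _ , split) , _) = acyclicSplit in split

      acyclic : ∀ i → _[_,_] Σ' U₁ U₂ i → prem i ⊆ U₁
      acyclic = proj₂ acyclicSplit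

    Violated : Imp n → Set
    Violated i = _[_,_] Σ' U₁ U₂ i × concl i ∉ C₂

    Triggered : Subset n → Set
    Triggered X = ∃ λ i → Violated i × prem i ⊆ X

    prem⊆U₁⇒prem⊈U₂ : ∀ i → prem i ⊆ U₁ → ¬ prem i ⊆ U₂
    prem⊆U₁⇒prem⊈U₂ i prem⊆U₁ prem⊆U₂ with prem-nonempty i
    ... | x , x∈prem = p∩q≡⊥⇒x∈p⇒x∉q U₁∩U₂≡⊥ (prem⊆U₁ x∈prem) (prem⊆U₂ x∈prem)

    cross⁺ : ∀ {i} → i ∈ₗ Σ' → ¬ (prem i ⊆ U₁ × concl i ∈ U₁) → ¬ (prem i ⊆ U₂ × concl i ∈ U₂) →
             _[_,_] Σ' U₁ U₂ i
    cross⁺ i∈Σ ¬inside₁ ¬inside₂ =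
      i∈Σ , (λ (_ , i⊆U₁) → ¬inside₁ (p∪⁅x⁆⊆⁻ i⊆U₁)) , (λ (_ , i⊆U₂) → ¬inside₂ (p∪⁅x⁆⊆⁻ i⊆U₂))

    cross-concl∈U₂ : ∀ {i} → _[_,_] Σ' U₁ U₂ i → concl i ∈ U₂
    cross-concl∈U₂ {i} cross@(i∈Σ , ∉Σ[U₁] , _)
      with x∈p∪q⁻ U₁ U₂ (subst (concl i ∈_) (sym U₁∪U₂≡⊤) ∈⊤)
    ... | inj₂ b∈U₂ = b∈U₂
    ... | inj₁ b∈U₁ = ⊥-elim (∉Σ[U₁] (i∈Σ , p∪⁅x⁆⊆⁺ (acyclic i cross) b∈U₁))

    Triggered⇒¬ExtRestr : ∀ {X} → Triggered X → ¬ ExtRestr Σ' U₁ U₂ C₂ X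
    Triggered⇒¬ExtRestr (i , (cross , b∉C₂) , prem⊆X) (C , (_ , C-sat) , C∩U₂≡C₂ , C∩U₁≡X) =
      b∉C₂ (subst (concl i ∈_) C∩U₂≡C₂ (x∈p∩q⁺ (b∈C , cross-concl∈U₂ cross)))
      where
      b∈C : concl i ∈ C
      b∈C = C-sat i (proj₁ cross) (λ a → p∩q⊆p C U₁ (subst (_ ∈_) (sym C∩U₁≡X) (prem⊆X a)))

    module _ {X : Subset n} (X-closed : Closed U₁ (Σ' [ U₁ ]) X) where

      [X∪C₂]∩U₁≡X : (X ∪ C₂) ∩ U₁ ≡ X
      [X∪C₂]∩U₁≡X = p⊆r∧q∩r≡⊥⇒[p∪q]∩r≡p (proj₁ X-closed)
                      (p⊆q∧q∩r≡⊥⇒p∩r≡⊥ (proj₁ C₂-closed) U₂∩U₁≡⊥)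

      [X∪C₂]∩U₂≡C₂ : (X ∪ C₂) ∩ U₂ ≡ C₂
      [X∪C₂]∩U₂≡C₂ = begin
        (X ∪ C₂) ∩ U₂  ≡⟨ cong (_∩ U₂) (∪-comm X C₂) ⟩
        (C₂ ∪ X) ∩ U₂  ≡⟨ p⊆r∧q∩r≡⊥⇒[p∪q]∩r≡p (proj₁ C₂-closed)
                            (p⊆q∧q∩r≡⊥⇒p∩r≡⊥ (proj₁ X-closed) U₁∩U₂≡⊥) ⟩
        C₂             ∎
        where open ≡-Reasoning

      ∈X : ∀ {x} → x ∈ U₁ → x ∈ X ∪ C₂ → x ∈ X
      ∈X x∈U₁ x∈X∪C₂ = subst (_ ∈_) [X∪C₂]∩U₁≡X (x∈p∩q⁺ (x∈X∪C₂ , x∈U₁))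

      ∈C₂ : ∀ {x} → x ∈ U₂ → x ∈ X ∪ C₂ → x ∈ C₂
      ∈C₂ x∈U₂ x∈X∪C₂ = subst (_ ∈_) [X∪C₂]∩U₂≡C₂ (x∈p∩q⁺ (x∈X∪C₂ , x∈U₂))

      fires-from-U₁ : ∀ {i} → i ∈ₗ Σ' → prem i ⊆ U₁ → prem i ⊆ X → ¬ Triggered X → concl i ∈ X ∪ C₂
      fires-from-U₁ {i} i∈Σ prem⊆U₁ prem⊆X untriggered with concl i ∈? U₁ | concl i ∈? C₂
      ... | yes b∈U₁ | _ = x∈p∪q⁺ (inj₁ (proj₂ X-closed i (i∈Σ , p∪⁅x⁆⊆⁺ prem⊆U₁ b∈U₁) prem⊆X))
      ... | no _ | yes b∈C₂ = x∈p∪q⁺ (inj₂ b∈C₂)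
      ... | no b∉U₁ | no b∉C₂ = ⊥-elim (untriggered (i , (cross , b∉C₂) , prem⊆X))
        where
        cross : _[_,_] Σ' U₁ U₂ i
        cross = cross⁺ i∈Σ (λ (_ , b∈U₁) → b∉U₁ b∈U₁)
                           (λ (prem⊆U₂ , _) → prem⊆U₁⇒prem⊈U₂ i prem⊆U₁ prem⊆U₂)

      fires-from-U₂ : ∀ {i} → i ∈ₗ Σ' → prem i ⊆ U₂ → prem i ⊆ C₂ → concl i ∈ X ∪ C₂
      fires-from-U₂ {i} i∈Σ prem⊆U₂ prem⊆C₂ with concl i ∈? U₂
      ... | yes b∈U₂ = x∈p∪q⁺ (inj₂ (proj₂ C₂-closed i (i∈Σ , p∪⁅x⁆⊆⁺ prem⊆U₂ b∈U₂) prem⊆C₂))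
      ... | no b∉U₂ = ⊥-elim (prem⊆U₁⇒prem⊈U₂ i (acyclic i cross) prem⊆U₂)
        where
        cross : _[_,_] Σ' U₁ U₂ i
        cross = cross⁺ i∈Σ (λ (prem⊆U₁ , _) → prem⊆U₁⇒prem⊈U₂ i prem⊆U₁ prem⊆U₂)
                           (λ (_ , b∈U₂) → b∉U₂ b∈U₂)

      X∪C₂-satisfies : ¬ Triggered X → Satisfies ⟦ Σ' ⟧ (X ∪ C₂)
      X∪C₂-satisfies untriggered i i∈Σ prem⊆X∪C₂ with split i i∈Σ
      ... | inj₁ prem⊆U₁ = fires-from-U₁ i∈Σ prem⊆U₁ (λ a → ∈X (prem⊆U₁ a) (prem⊆X∪C₂ a)) untriggered
      ... | inj₂ prem⊆U₂ = fires-from-U₂ i∈Σ prem⊆U₂ (λ a → ∈C₂ (prem⊆U₂ a) (prem⊆X∪C₂ a))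

      ¬Triggered⇒ExtRestr : ¬ Triggered X → ExtRestr Σ' U₁ U₂ C₂ X
      ¬Triggered⇒ExtRestr untriggered =
        X ∪ C₂ , (⊆⊤ , X∪C₂-satisfies untriggered) , [X∪C₂]∩U₂≡C₂ , [X∪C₂]∩U₁≡X

    triggered? : ∀ X → Dec (Triggered X)
    triggered? X with any? (λ i → ¬? (prem i ∪ ⁅ concl i ⁆ ⊆? U₁) ×-dec ¬? (prem i ∪ ⁅ concl i ⁆ ⊆? U₂)
                                   ×-dec ¬? (concl i ∈? C₂) ×-dec prem i ⊆? X) Σ'
    ... | yes found with find found
    ...   | i , i∈Σ , ¬i⊆U₁ , ¬i⊆U₂ , b∉C₂ , prem⊆X =
            yes (i , ((i∈Σ , (λ (_ , i⊆U₁) → ¬i⊆U₁ i⊆U₁) , (λ (_ , i⊆U₂) → ¬i⊆U₂ i⊆U₂)) , b∉C₂) , prem⊆X)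
    triggered? X | no none = no λ (i , ((i∈Σ , ∉Σ[U₁] , ∉Σ[U₂]) , b∉C₂) , prem⊆X) →
      none (lose i∈Σ ((λ i⊆U₁ → ∉Σ[U₁] (i∈Σ , i⊆U₁)) , (λ i⊆U₂ → ∉Σ[U₂] (i∈Σ , i⊆U₂)) , b∉C₂ , prem⊆X))

    ¬ExtRestr⇔Triggered : ∀ {X} → (Closed U₁ (Σ' [ U₁ ]) X × ¬ ExtRestr Σ' U₁ U₂ C₂ X)
                                  ⇔ (Closed U₁ (Σ' [ U₁ ]) X × Triggered X)
    ¬ExtRestr⇔Triggered {X} =
      mk⇔ (λ (X-closed , ¬ext) → X-closed ,
                  decidable-stable (triggered? X) (λ untriggered → ¬ext (¬Triggered⇒ExtRestr X-closed untriggered)))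
          (λ (X-closed , triggered) → X-closed , Triggered⇒¬ExtRestr triggered)

    ∃Violated-assoc : ∀ {Y} → (∃ λ i → Violated i × IsClosureOf U₁ (Σ' [ U₁ ]) (prem i) Y)
                            ⇔ (∃ λ i → _[_,_] Σ' U₁ U₂ i × concl i ∉ C₂ × IsClosureOf U₁ (Σ' [ U₁ ]) (prem i) Y)
    ∃Violated-assoc = mk⇔ (λ (i , (cross , b∉C₂) , closure) → i , cross , b∉C₂ , closure)
                          (λ (i , cross , b∉C₂ , closure) → i , (cross , b∉C₂) , closure)

proposition8 : ∀ {n} (Σ' : Base n) (U₁ U₂ : Subset n) →
    IsAcyclicSplit Σ' U₁ U₂ →
    ∀ (C₂ : Subset n) → Closed U₂ (Σ' [ U₂ ]) C₂ →
    ∀ (C₁ : Subset n) → Closed U₁ (Σ' [ U₁ ]) C₁ →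
    Min (λ C → Closed U₁ (Σ' [ U₁ ]) C × ¬ ExtRestr Σ' U₁ U₂ C₂ C) C₁
    ⇔ Min (λ Y → ∃ λ i → (Σ' [ U₁ , U₂ ]) i × concl i ∉ C₂ ×
    IsClosureOf U₁ (Σ' [ U₁ ]) (prem i) Y) C₁
-- The hypothesis C₁ ∈ 𝒞₁ is redundant: membership in either family already implies it.
proposition8 Σ' U₁ U₂ acyclicSplit C₂ C₂-closed C₁ _ =
  ⇔-trans (Min-cong ¬ExtRestr⇔Triggered)
    (⇔-trans (Min-generated⇔Min-closure (closed? Σ' U₁) Violated prem) (Min-cong ∃Violated-assoc))
  where open AcyclicSplit Σ' acyclicSplit C₂-closed
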